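{- Let $i\ge 3$ and, for $0\le j\le i-1$, let $\Theta_{i,j}$ be the set of starting positions of the occurrences of $F_{i-j}$ in $F_i$. Then $\Theta_{i,0}=\Theta_{i,1}=\{1\}$, and for every $j$ with $2\le j\le i-4$: (i) if $j$ is even, $\Theta_{i,j}=\Theta_{i,j-1}\cup(\Theta_{i,j-2}\oplus f_{i-j})\cup\{f_i-f_{i-j}+1\}$, the three sets in this union are mutually disjoint, and $\max(\Theta_{i,j})=f_i-f_{i-j}+1$; (ii) if $j$ is odd, $\Theta_{i,j}=\Theta_{i,j-1}\cup(\Theta_{i,j-2}\oplus f_{i-j})$, the two sets in this union are disjoint, and $\max(\Theta_{i,j})=f_i-f_{i-(j-1)}+1$.
   Context: Fibonacci words: $F_1=\texttt{b}$, $F_2=\texttt{a}$, $F_k=F_{k-1}F_{k-2}$ for $k\ge 3$; $f_k=|F_k|$. Positions are 1-indexed; $S$ occurs at position $p$ in $T$ if $T[p\ldots p+|S|-1]=S$. For a set of integers $A$ and an integer $c$, $A\oplus c:=\{a+c : a\in A\}$, and $\max(A)$ is its largest element. -}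

module Defs where

open import Data.Nat using (ℕ; zero; suc; _+_; _∸_; _≤_)
open import Data.List using (List; []; _∷_; _++_; length; take; drop)
open import Data.Product using (Σ; _×_)
open import Data.Sum using (_⊎_)
open import Data.Empty using (⊥)
open import Relation.Nullary using (¬_)
open import Relation.Binary.PropositionalEquality using (_≡_)
open import Function.Bundles using (_⇔_)

data Letter : Set where
  a b : Letter

-- Fibonacci words: F 1 = b, F 2 = a, F k = F (k-1) F (k-2) for k ≥ 3.
-- F 0 = [] is a dummy value, never used by the statement.
F : ℕ → List Letter
F zero = []
F (suc zero) = b ∷ []
F (suc (suc zero)) = a ∷ []
F (suc (suc (suc k))) = F (suc (suc k)) ++ F (suc k)

f : ℕ → ℕ
f k = length (F k)

-- S occurs at (1-indexed) position p in T: p ≥ 1 and T[p .. p+|S|-1] = S.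
OccursAt : List Letter → List Letter → ℕ → Set
OccursAt S T p = (1 ≤ p) × (take (length S) (drop (p ∸ 1) T) ≡ S)

NSet : Set₁
NSet = ℕ → Set

Θ : ℕ → ℕ → NSet
Θ i j p = OccursAt (F (i ∸ j)) (F i) p

singleton : ℕ → NSet
singleton n p = p ≡ n

_∪_ : NSet → NSet → NSet
(A ∪ B) p = A p ⊎ B p

_⊕_ : NSet → ℕ → NSet
(A ⊕ c) p = Σ ℕ (λ x → A x × (p ≡ x + c))

_≐_ : NSet → NSet → Set
A ≐ B = ∀ p → A p ⇔ B p

Disjoint : NSet → NSet → Set
Disjoint A B = ∀ p → ¬ (A p × B p)

IsMax : NSet → ℕ → Set
IsMax A m = A m × (∀ p → A p → p ≤ m)

{-# OPTIONS --safe #-}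
-- Let φ be the Fibonacci morphism a ↦ ab, b ↦ a, so that φᵏ (F r) = F (r + k).  Every
-- occurrence of F (k + 3) in φᵏ⁺¹ w starts at the image of a suffix of w; this goes by induction
-- on k, because images under φ contain no bb, every b in them follows an a, and
-- F (r + 2) F (r + 1) ≠ F (r + 1) F (r + 2).  Put n = i − j = k + 4 and read F i as
-- φᵏ⁺² (F (j + 2)).  An occurrence of F n then starts at the image of a letter of F (j + 2): an a
-- followed by a letter yields an occurrence of F (n + 1) = F n F (n − 1); a b, which always sits
-- inside aba, yields the second F n of an occurrence of F (n + 2) = F n F (n − 1) F n; a final a,
-- present exactly when j is even, yields the last position f i − f n + 1.  The three kinds are
-- told apart by F (n − 1) F n ≠ F n F (n − 1) and by length, and the same length count gives
-- the maxima.
module Submission where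

open import Defs
open import Data.Nat using (ℕ; zero; suc; _+_; _∸_; _≤_; _%_; z≤n; s≤s)
open import Data.Nat.Properties
  using (suc-injective; +-suc; +-assoc; +-comm; +-identityʳ; m≤m+n; ≤-trans; ≤-reflexive; ≤-antisym;
         m+n∸n≡m; m+n∸m≡n; m+[n∸m]≡n; n∸n≡0; m+1+n≢m; +-commutativeSemigroup)
open import Data.List using (List; []; _∷_; _++_; length; take; drop; concatMap)
open import Data.List.Properties
  using (∷-injective; ∷-injectiveʳ; ++-assoc; ++-identityʳ; ++-identityʳ-unique; ++-cancelˡ; ++-conicalˡ;
         length-++; length-++-comm; take++drop≡id; take-[]; concatMap-++; ∷ʳ-injectiveʳ)
open import Data.Product using (∃; _×_; _,_)
open import Data.Sum using (inj₁; inj₂)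
open import Data.Empty using (⊥-elim)
open import Relation.Binary.PropositionalEquality
  using (_≡_; _≢_; refl; sym; trans; cong; cong₂; subst; module ≡-Reasoning)
open import Function.Bundles using (mk⇔)
open import Algebra.Properties.CommutativeSemigroup +-commutativeSemigroup using (x∙yz≈y∙xz)

open ≡-Reasoning

Word : Set
Word = List Letter

private
  variable
    A : Set
    p q : ℕ
    S S′ T G w z : Word

take-length-++ : ∀ (xs ys : List A) → take (length xs) (xs ++ ys) ≡ xs
take-length-++ []       ys = refl
take-length-++ (x ∷ xs) ys = cong (x ∷_) (take-length-++ xs ys)

drop-length-++ : ∀ (xs ys : List A) → drop (length xs) (xs ++ ys) ≡ ys
drop-length-++ []       ys = refl
drop-length-++ (x ∷ xs) ys = drop-length-++ xs ys

++-cancelˡ-≡-length : ∀ (xs ys : List A) {us vs} → length xs ≡ length ys → xs ++ us ≡ ys ++ vs → us ≡ vs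
++-cancelˡ-≡-length []       []       _   eq = eq
++-cancelˡ-≡-length (x ∷ xs) (y ∷ ys) len eq = ++-cancelˡ-≡-length xs ys (suc-injective len) (∷-injectiveʳ eq)

-- Occurrences as factorisations

record Occurrence (S T : Word) (p : ℕ) : Set where
  constructor occurrence
  field
    before after : Word
    split        : T ≡ before ++ S ++ after
    position     : p ≡ suc (length before)
open Occurrence

occurrence⇒occursAt : Occurrence S T p → OccursAt S T p
occurrence⇒occursAt {S} (occurrence x y refl refl) = s≤s z≤n , (begin
  take (length S) (drop (length x) (x ++ S ++ y)) ≡⟨ cong (take (length S)) (drop-length-++ x (S ++ y)) ⟩
  take (length S) (S ++ y)                         ≡⟨ take-length-++ S y ⟩
  S                                                ∎)

take-drop⇒occurrence : ∀ m T → S ≢ [] → take (length S) (drop m T) ≡ S → Occurrence S T (suc m)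
take-drop⇒occurrence {S} zero T _ eq =
  occurrence [] (drop (length S) T) (trans (sym (take++drop≡id (length S) T)) (cong (_++ drop (length S) T) eq)) refl
take-drop⇒occurrence {S} (suc m) [] S≢[] eq = ⊥-elim (S≢[] (trans (sym eq) (take-[] (length S))))
take-drop⇒occurrence (suc m) (t ∷ T) S≢[] eq with take-drop⇒occurrence m T S≢[] eq
... | occurrence x y refl refl = occurrence (t ∷ x) y refl refl

occursAt⇒occurrence : S ≢ [] → OccursAt S T p → Occurrence S T p
occursAt⇒occurrence {T = T} {p = suc m} S≢[] (_ , eq) = take-drop⇒occurrence m T S≢[] eq

occurrence-last-position : (o : Occurrence S T p) → length T ∸ length S + 1 ≡ p + length (after o)
occurrence-last-position {S} (occurrence x y refl refl) = begin
  length (x ++ S ++ y) ∸ length S + 1            ≡⟨ cong (λ l → l ∸ length S + 1) |x++S++y| ⟩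
  length x + length y + length S ∸ length S + 1  ≡⟨ cong (_+ 1) (m+n∸n≡m (length x + length y) (length S)) ⟩
  length x + length y + 1                        ≡⟨ +-comm (length x + length y) 1 ⟩
  suc (length x) + length y                      ∎
  where
  |x++S++y| : length (x ++ S ++ y) ≡ length x + length y + length S
  |x++S++y| = begin
    length (x ++ S ++ y)             ≡⟨ length-++ x ⟩
    length x + length (S ++ y)       ≡⟨ cong (length x +_) (length-++-comm S y) ⟩
    length x + length (y ++ S)       ≡⟨ cong (length x +_) (length-++ y) ⟩
    length x + (length y + length S) ≡⟨ +-assoc (length x) (length y) (length S) ⟨
    length x + length y + length S   ∎

occurrence-bound : Occurrence S T p → p ≤ length T ∸ length S + 1
occurrence-bound o = ≤-trans (m≤m+n _ _) (≤-reflexive (sym (occurrence-last-position o)))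

after≡[]⇒last-position : (o : Occurrence S T p) → after o ≡ [] → p ≡ length T ∸ length S + 1
after≡[]⇒last-position {p = p} o refl = trans (sym (+-identityʳ p)) (sym (occurrence-last-position o))

last-position⇒after≡[] : (o : Occurrence S T p) → p ≡ length T ∸ length S + 1 → after o ≡ []
last-position⇒after≡[] {p = p} o final with after o | occurrence-last-position o
... | []    | _    = refl
... | _ ∷ _ | last = ⊥-elim (m+1+n≢m p (trans (sym last) (sym final)))

suffix-occurrence : T ≡ G ++ S → Occurrence S T (length T ∸ length S + 1)
suffix-occurrence {T} {G} {S} T≡GS = subst (Occurrence S T) (after≡[]⇒last-position o refl) o
  where
  o : Occurrence S T (suc (length G))
  o = occurrence G [] (trans T≡GS (cong (G ++_) (sym (++-identityʳ S)))) refl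

occurrence-prefix : Occurrence (S ++ S′) T p → Occurrence S T p
occurrence-prefix {S} {S′} o =
  occurrence (before o) (S′ ++ after o) (trans (split o) (cong (before o ++_) (++-assoc S S′ (after o)))) (position o)

occurrence-suffix : Occurrence (S ++ S′) T p → Occurrence S′ T (p + length S)
occurrence-suffix {S} {S′} o =
  occurrence (before o ++ S) (after o)
    (trans (split o) (trans (cong (before o ++_) (++-assoc S S′ (after o))) (sym (++-assoc (before o) S _))))
    (trans (cong (_+ length S) (position o)) (cong suc (sym (length-++ (before o)))))

occurrence-extend : (o : Occurrence S T p) → after o ≡ S′ ++ z → Occurrence (S ++ S′) T p
occurrence-extend {S} {S′ = S′} {z} o after≡ =
  occurrence (before o) z
    (trans (split o) (cong (before o ++_) (trans (cong (S ++_) after≡) (sym (++-assoc S S′ z))))) (position o)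

occurrences-at-same-position : (o : Occurrence S T p) (o′ : Occurrence S′ T p) → S ++ after o ≡ S′ ++ after o′
occurrences-at-same-position (occurrence x y refl refl) (occurrence x′ y′ split′ position′) =
  ++-cancelˡ-≡-length x x′ (suc-injective position′) split′

self-occurrences : S ≢ [] → OccursAt S S ≐ singleton 1
self-occurrences {S} S≢[] p = mk⇔ only-first (λ { refl → occurrence⇒occursAt first })
  where
  first : Occurrence S S 1
  first = occurrence [] [] (sym (++-identityʳ S)) refl
  only-first : OccursAt S S p → p ≡ 1
  only-first occ@(1≤p , _) = ≤-antisym
    (subst (λ l → p ≤ l + 1) (n∸n≡0 (length S)) (occurrence-bound (occursAt⇒occurrence S≢[] occ))) 1≤p

a≢b : a ≢ b
a≢b ()

F-nonempty : ∀ r → F (suc r) ≢ []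
F-nonempty zero          ()
F-nonempty (suc zero)    ()
F-nonempty (suc (suc r)) eq = F-nonempty (suc r) (++-conicalˡ _ _ eq)

F-not-prefix : ∀ r y → F (2 + r) ≢ F (3 + r) ++ y
F-not-prefix r y eq = F-nonempty r (++-conicalˡ _ _ (++-identityʳ-unique (F (2 + r))
  (trans eq (++-assoc (F (2 + r)) (F (1 + r)) y))))

F-noncommuting : ∀ r {u v} → F (2 + r) ++ F (1 + r) ++ u ≢ F (1 + r) ++ F (2 + r) ++ v
F-noncommuting zero    ()
F-noncommuting (suc r) {u} {v} eq = F-noncommuting r (sym (++-cancelˡ (F (2 + r)) _ _ (begin
  F (2 + r) ++ F (1 + r) ++ F (2 + r) ++ u   ≡⟨ ++-assoc (F (2 + r)) (F (1 + r)) _ ⟨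
  F (3 + r) ++ F (2 + r) ++ u                ≡⟨ eq ⟩
  F (2 + r) ++ F (3 + r) ++ v                ≡⟨ cong (F (2 + r) ++_) (++-assoc (F (2 + r)) (F (1 + r)) v) ⟩
  F (2 + r) ++ F (2 + r) ++ F (1 + r) ++ v   ∎)))

F-overlap : ∀ r → F (3 + r) ++ F (4 + r) ≡ F (4 + r) ++ F (1 + r) ++ F (2 + r)
F-overlap r = begin
  F (3 + r) ++ F (3 + r) ++ F (2 + r)
    ≡⟨ cong (F (3 + r) ++_) (++-assoc (F (2 + r)) (F (1 + r)) (F (2 + r))) ⟩
  F (3 + r) ++ F (2 + r) ++ F (1 + r) ++ F (2 + r)
    ≡⟨ ++-assoc (F (3 + r)) (F (2 + r)) _ ⟨
  F (4 + r) ++ F (1 + r) ++ F (2 + r)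
    ∎

F-suffix : ∀ j r → ∃ λ G → F (j + suc r) ≡ G ++ F (j % 2 + suc r)
F-suffix zero          r = [] , refl
F-suffix (suc zero)    r = [] , refl
F-suffix (suc (suc j)) r with G , F≡GF ← F-suffix j r = F (2 + (j + r)) ++ G , (begin
  F (2 + (j + suc r))                          ≡⟨ cong (λ m → F (2 + m)) (+-suc j r) ⟩
  F (2 + (j + r)) ++ F (1 + (j + r))           ≡⟨ cong (λ m → F (2 + (j + r)) ++ F m) (+-suc j r) ⟨
  F (2 + (j + r)) ++ F (j + suc r)             ≡⟨ cong (F (2 + (j + r)) ++_) F≡GF ⟩
  F (2 + (j + r)) ++ G ++ F (j % 2 + suc r)    ≡⟨ ++-assoc (F (2 + (j + r))) G _ ⟨
  (F (2 + (j + r)) ++ G) ++ F (j % 2 + suc r)  ∎)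

F-shifted-occurrence : ∀ k → Occurrence (F (6 + k)) T q →
                       Occurrence (F (4 + k) ++ F (1 + k) ++ F (2 + k)) T (q + f (4 + k))
F-shifted-occurrence {T} {q} k o =
  subst (λ S → Occurrence S T (q + f (4 + k))) (F-overlap k)
    (occurrence-suffix {S = F (4 + k)}
      (subst (λ S → Occurrence S T q) (++-assoc (F (4 + k)) (F (3 + k)) (F (4 + k))) o))

-- The Fibonacci morphism

block : ℕ → Letter → Word
block k a = F (2 + k)
block k b = F (1 + k)

-- φ^ k is the k-th iterate of φ = φ^ 1 : a ↦ ab, b ↦ a (see φ^-suc).
φ^ : ℕ → Word → Word
φ^ k = concatMap (block k)

φ : Word → Word
φ = φ^ 1

φ^-++ : ∀ k u v → φ^ k (u ++ v) ≡ φ^ k u ++ φ^ k v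
φ^-++ k = concatMap-++ (block k)

φ^-suc : ∀ k w → φ^ (suc k) w ≡ φ^ k (φ w)
φ^-suc k []      = refl
φ^-suc k (a ∷ w) = trans (++-assoc (F (2 + k)) (F (1 + k)) _)
  (cong (λ u → F (2 + k) ++ F (1 + k) ++ u) (φ^-suc k w))
φ^-suc k (b ∷ w) = cong (F (2 + k) ++_) (φ^-suc k w)

φ^-F : ∀ k r → φ^ k (F (suc r)) ≡ F (suc r + k)
φ^-F k zero          = ++-identityʳ (F (1 + k))
φ^-F k (suc zero)    = ++-identityʳ (F (2 + k))
φ^-F k (suc (suc r)) = trans (φ^-++ k (F (2 + r)) (F (1 + r))) (cong₂ _++_ (φ^-F k (suc r)) (φ^-F k r))

block-prefix : ∀ k c → ∃ λ z → block (suc k) c ≡ F (2 + k) ++ z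
block-prefix k a = F (1 + k) , refl
block-prefix k b = [] , sym (++-identityʳ (F (2 + k)))

φ-head : ∀ v {c r} → φ v ≡ c ∷ r → c ≡ a
φ-head (a ∷ v) refl = refl
φ-head (b ∷ v) refl = refl

φ-b-context : ∀ w u s → φ w ≡ u ++ b ∷ s → (∃ λ u′ → u ≡ u′ ++ a ∷ []) × (∃ λ v → φ v ≡ s)
φ-b-context []      []      s ()
φ-b-context []      (_ ∷ _) s ()
φ-b-context (a ∷ w) []      s ()
φ-b-context (a ∷ w) (c ∷ []) s refl = ([] , refl) , (w , refl)
φ-b-context (a ∷ w) (c ∷ d ∷ u) s eq
  with (u′ , refl) , image ← φ-b-context w u s (∷-injectiveʳ (∷-injectiveʳ eq)) = (c ∷ d ∷ u′ , refl) , image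
φ-b-context (b ∷ w) []      s ()
φ-b-context (b ∷ w) (c ∷ u) s eq
  with (u′ , refl) , image ← φ-b-context w u s (∷-injectiveʳ eq) = (c ∷ u′ , refl) , image

φ-no-bb : ∀ w u {c r} → φ w ≡ u ++ b ∷ c ∷ r → c ≡ a
φ-no-bb w u eq with _ , (v , φv≡) ← φ-b-context w u _ eq = φ-head v φv≡

record Preimage (k : ℕ) (w x z : Word) : Set where
  constructor preimage
  field
    left right  : Word
    split       : w ≡ left ++ right
    left-image  : φ^ k left ≡ x
    right-image : φ^ k right ≡ z

φ-a-boundary : ∀ w x r → φ w ≡ x ++ a ∷ r → Preimage 1 w x (a ∷ r)
φ-a-boundary w       []          r eq = preimage [] w refl refl eq
φ-a-boundary []      (_ ∷ _)     r ()
φ-a-boundary (a ∷ w) (_ ∷ [])    r ()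
φ-a-boundary (a ∷ w) (c ∷ d ∷ x) r eq with ∷-injective eq
... | refl , eq′ with ∷-injective eq′
... | refl , eq″ with preimage w₁ w₂ refl refl image ← φ-a-boundary w x r eq″ =
  preimage (a ∷ w₁) w₂ refl refl image
φ-a-boundary (b ∷ w) (c ∷ x)     r eq with ∷-injective eq
... | refl , eq′ with preimage w₁ w₂ refl refl image ← φ-a-boundary w x r eq′ =
  preimage (b ∷ w₁) w₂ refl refl image

-- In the step, one level down the occurrence starts at the image of a letter of φ w.  That letter
-- is not b: a final b is too short, every other b in φ w is followed by an a, and
-- F (k + 2) F (k + 3) ≠ F (k + 3) F (k + 2).
occurrence-at-boundary : ∀ k w x y → φ^ (suc k) w ≡ x ++ F (3 + k) ++ y →
                         Preimage (suc k) w x (F (3 + k) ++ y)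
occurrence-at-boundary zero    w x y eq = φ-a-boundary w x (b ∷ y) eq
occurrence-at-boundary (suc k) w x y eq = lift (occurrence-at-boundary k (φ w) x (F (2 + k) ++ y) eq′)
  where
  eq′ : φ^ (suc k) (φ w) ≡ x ++ F (3 + k) ++ F (2 + k) ++ y
  eq′ = trans (sym (φ^-suc (suc k) w)) (trans eq (cong (x ++_) (++-assoc (F (3 + k)) (F (2 + k)) y)))
  lift : Preimage (suc k) (φ w) x (F (3 + k) ++ F (2 + k) ++ y) → Preimage (2 + k) w x (F (4 + k) ++ y)
  lift (preimage u₁ [] _ _ image) = ⊥-elim (F-nonempty (2 + k) (++-conicalˡ _ _ (sym image)))
  lift (preimage u₁ (b ∷ []) _ _ image) =
    ⊥-elim (F-not-prefix k (F (2 + k) ++ y) (trans (sym (++-identityʳ (F (2 + k)))) image))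
  lift (preimage u₁ (b ∷ c ∷ r) split _ image) with refl ← φ-no-bb w u₁ split =
    ⊥-elim (F-noncommuting (suc k) (sym image))
  lift (preimage u₁ (a ∷ r) split u₁-image image)
    with preimage v₁ v₂ w≡ v₁-image v₂-image ← φ-a-boundary w u₁ r split =
    preimage v₁ v₂ w≡
      (begin
        φ^ (2 + k) v₁                 ≡⟨ φ^-suc (suc k) v₁ ⟩
        φ^ (suc k) (φ v₁)             ≡⟨ cong (φ^ (suc k)) v₁-image ⟩
        φ^ (suc k) u₁                 ≡⟨ u₁-image ⟩
        x                             ∎)
      (begin
        φ^ (2 + k) v₂                 ≡⟨ φ^-suc (suc k) v₂ ⟩
        φ^ (suc k) (φ v₂)             ≡⟨ cong (φ^ (suc k)) v₂-image ⟩
        φ^ (suc k) (a ∷ r)            ≡⟨ image ⟩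
        F (3 + k) ++ F (2 + k) ++ y   ≡⟨ ++-assoc (F (3 + k)) (F (2 + k)) y ⟨
        F (4 + k) ++ y                ∎)

image-occurrence : ∀ k u s r → T ≡ φ^ k (u ++ s ++ r) → Occurrence (φ^ k s) T (suc (length (φ^ k u)))
image-occurrence k u s r T≡ = occurrence (φ^ k u) (φ^ k r)
  (trans T≡ (trans (φ^-++ k u (s ++ r)) (cong (φ^ k u ++_) (φ^-++ k s r)))) refl

data Origin (k : ℕ) (v T : Word) (p : ℕ) : Set where
  inside  : Occurrence (F (5 + k)) T p → Origin k v T p
  shifted : Occurrence (F (6 + k)) T q → p ≡ q + f (4 + k) → Origin k v T p
  final   : p ≡ length T ∸ f (4 + k) + 1 → φ v ≡ w ++ a ∷ [] → Origin k v T p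

-- Classify by the letter of φ v at which the occurrence starts: an a followed by a letter, the b of
-- an aba, or a final a.
occurrence-origin : ∀ k v → T ≡ φ^ (2 + k) (φ v) → Occurrence (F (4 + k)) T p → Origin k v T p
occurrence-origin {T} {p} k v T≡ o@(occurrence x y T≡xFy p≡) =
  classify (occurrence-at-boundary (suc k) (φ v) x y (trans (sym T≡) T≡xFy))
  where
  classify : Preimage (2 + k) (φ v) x (F (4 + k) ++ y) → Origin k v T p
  classify (preimage w₁ [] _ _ image) = ⊥-elim (F-nonempty (3 + k) (++-conicalˡ _ _ (sym image)))
  classify (preimage w₁ (b ∷ []) _ _ image) =
    ⊥-elim (F-not-prefix (suc k) y (trans (sym (++-identityʳ (F (3 + k)))) image))
  classify (preimage w₁ (a ∷ []) split _ image) =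
    final (after≡[]⇒last-position o (sym (++-cancelˡ (F (4 + k)) _ _ image))) split
  classify (preimage w₁ (a ∷ c ∷ r) _ _ image) with z , block≡ ← block-prefix (suc k) c =
    inside (occurrence-extend o (begin
      y                                      ≡⟨ ++-cancelˡ (F (4 + k)) _ _ image ⟨
      block (2 + k) c ++ φ^ (2 + k) r        ≡⟨ cong (_++ φ^ (2 + k) r) block≡ ⟩
      (F (3 + k) ++ z) ++ φ^ (2 + k) r       ≡⟨ ++-assoc (F (3 + k)) z _ ⟩
      F (3 + k) ++ z ++ φ^ (2 + k) r         ∎))
  classify (preimage w₁ (b ∷ c ∷ r) split w₁-image _)
    with (u , refl) , _ ← φ-b-context v w₁ (c ∷ r) split | refl ← φ-no-bb v w₁ split =
    shifted (subst (λ S → Occurrence S T (suc (length (φ^ (2 + k) u)))) (φ^-F (2 + k) 3)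
              (image-occurrence (2 + k) u (F 4) r
                (trans T≡ (cong (φ^ (2 + k)) (trans split (++-assoc u _ _))))))
            (begin
              p                                                ≡⟨ p≡ ⟩
              suc (length x)                                   ≡⟨ cong (λ x → suc (length x)) w₁-image ⟨
              suc (length (φ^ (2 + k) (u ++ a ∷ [])))          ≡⟨ cong (λ x → suc (length x)) (φ^-++ (2 + k) u (a ∷ [])) ⟩
              suc (length (φ^ (2 + k) u ++ F (4 + k) ++ []))   ≡⟨ cong suc (length-++ (φ^ (2 + k) u)) ⟩
              suc (length (φ^ (2 + k) u) + length (F (4 + k) ++ []))
                ≡⟨ cong (λ S → suc (length (φ^ (2 + k) u) + length S)) (++-identityʳ (F (4 + k))) ⟩
              suc (length (φ^ (2 + k) u)) + f (4 + k)          ∎)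

F-successor-occurrence : ∀ q → Occurrence (F (2 + q)) (F (3 + q)) p → p ≡ 1
F-successor-occurrence zero (occurrence x y split refl) with φ-a-boundary (a ∷ []) x y split
... | preimage []          _       _  refl _ = refl
... | preimage (a ∷ [])    []      _  _    ()
... | preimage (a ∷ [])    (_ ∷ _) () _    _
... | preimage (a ∷ _ ∷ _) _       () _    _
... | preimage (b ∷ _)     _       () _    _
F-successor-occurrence (suc q) (occurrence x y split refl)
  with occurrence-at-boundary q (F 3) x y (trans (φ^-F (suc q) 2) split)
... | preimage []              _ _    refl _     = refl
... | preimage (a ∷ [])        _ refl _    image =
  ⊥-elim (F-not-prefix q y (trans (sym (++-identityʳ (F (2 + q)))) image))
... | preimage (a ∷ b ∷ [])    _ refl _    image =
  ⊥-elim (F-nonempty (2 + q) (++-conicalˡ _ _ (sym image)))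
... | preimage (a ∷ a ∷ _)     _ ()   _    _
... | preimage (a ∷ b ∷ _ ∷ _) _ ()   _    _
... | preimage (b ∷ _)         _ ()   _    _

F-successor-occurrences : ∀ q → OccursAt (F (2 + q)) (F (3 + q)) ≐ singleton 1
F-successor-occurrences q p = mk⇔
  (λ occ → F-successor-occurrence q (occursAt⇒occurrence (F-nonempty (suc q)) occ))
  (λ { refl → occurrence⇒occursAt (occurrence [] (F (1 + q)) refl refl) })

module _ (i : ℕ) where
  private
    O : ℕ → NSet
    O d = OccursAt (F d) (F i)

  EvenCase : (d₀ d₁ d₂ : ℕ) → Set
  EvenCase d₀ d₁ d₂ =
    (O d₀ ≐ ((O d₁ ∪ (O d₂ ⊕ f d₀)) ∪ singleton (f i ∸ f d₀ + 1)))
    × Disjoint (O d₁) (O d₂ ⊕ f d₀)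
    × Disjoint (O d₁) (singleton (f i ∸ f d₀ + 1))
    × Disjoint (O d₂ ⊕ f d₀) (singleton (f i ∸ f d₀ + 1))
    × IsMax (O d₀) (f i ∸ f d₀ + 1)

  OddCase : (d₀ d₁ d₂ : ℕ) → Set
  OddCase d₀ d₁ d₂ =
    (O d₀ ≐ (O d₁ ∪ (O d₂ ⊕ f d₀)))
    × Disjoint (O d₁) (O d₂ ⊕ f d₀)
    × IsMax (O d₀) (f i ∸ f d₁ + 1)

-- j is the paper's j, and n = i − j = 4 + k.
module Recurrence (j k : ℕ) where
  i : ℕ
  i = j + (4 + k)

  private
    O : ℕ → NSet
    O d = OccursAt (F d) (F i)

    occ : ∀ d → O (suc d) p → Occurrence (F (suc d)) (F i) p
    occ d = occursAt⇒occurrence (F-nonempty d)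

    F-image : F i ≡ φ^ (2 + k) (φ (F (suc j)))
    F-image = begin
      F (j + (4 + k))               ≡⟨ cong F (trans (+-suc j (3 + k)) (cong suc (sym (+-assoc j 1 (2 + k))))) ⟩
      F (suc (j + 1) + (2 + k))     ≡⟨ φ^-F (2 + k) (j + 1) ⟨
      φ^ (2 + k) (F (suc (j + 1)))  ≡⟨ cong (φ^ (2 + k)) (φ^-F 1 j) ⟨
      φ^ (2 + k) (φ (F (suc j)))    ∎

    preimage-not-ending-in-a : j % 2 ≡ 1 → φ (F (suc j)) ≢ w ++ a ∷ []
    preimage-not-ending-in-a {w} j-odd φF≡
      with G , F≡ ← F-suffix j 1 = a≢b (∷ʳ-injectiveʳ w (G ++ a ∷ []) (begin
      w ++ a ∷ []               ≡⟨ φF≡ ⟨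
      φ (F (suc j))             ≡⟨ φ^-F 1 j ⟩
      F (suc (j + 1))           ≡⟨ cong F (+-suc j 1) ⟨
      F (j + 2)                 ≡⟨ subst (λ m → F (j + 2) ≡ G ++ F (m + 2)) j-odd F≡ ⟩
      G ++ a ∷ b ∷ []           ≡⟨ ++-assoc G (a ∷ []) (b ∷ []) ⟨
      (G ++ a ∷ []) ++ b ∷ []   ∎))

    origin : O (4 + k) p → Origin k (F (suc j)) (F i) p
    origin o = occurrence-origin k (F (suc j)) F-image (occ (3 + k) o)

    inside⊆ : O (5 + k) p → O (4 + k) p
    inside⊆ o = occurrence⇒occursAt (occurrence-prefix {S = F (4 + k)} (occ (4 + k) o))

    shifted⊆ : O (6 + k) q → O (4 + k) (q + f (4 + k))
    shifted⊆ o =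
      occurrence⇒occursAt (occurrence-prefix {S = F (4 + k)} (F-shifted-occurrence k (occ (5 + k) o)))

    final-occurrence : ∀ {m} → j % 2 ≡ m → O (m + (4 + k)) (f i ∸ f (m + (4 + k)) + 1)
    final-occurrence refl with G , F≡ ← F-suffix j (3 + k) = occurrence⇒occursAt (suffix-occurrence F≡)

    last-position : ℕ
    last-position = f i ∸ f (4 + k) + 1

    inside-shifted-disjoint : Disjoint (O (5 + k)) (O (6 + k) ⊕ f (4 + k))
    inside-shifted-disjoint p (o , q , o′ , refl) = F-noncommuting k (begin
      F (2 + k) ++ F (1 + k) ++ after tail          ≡⟨ ++-assoc (F (2 + k)) (F (1 + k)) _ ⟨
      F (3 + k) ++ after tail                       ≡⟨ occurrences-at-same-position tail tail′ ⟩
      (F (1 + k) ++ F (2 + k)) ++ after tail′       ≡⟨ ++-assoc (F (1 + k)) (F (2 + k)) _ ⟩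
      F (1 + k) ++ F (2 + k) ++ after tail′         ∎)
      where
      tail  = occurrence-suffix {S = F (4 + k)} (occ (4 + k) o)
      tail′ = occurrence-suffix {S = F (4 + k)} (F-shifted-occurrence k (occ (5 + k) o′))

    inside-not-final : Disjoint (O (5 + k)) (singleton last-position)
    inside-not-final p (o , p≡last) = F-nonempty (2 + k) (++-conicalˡ _ _
      (last-position⇒after≡[] (occurrence-prefix {S = F (4 + k)} (occ (4 + k) o)) p≡last))

    shifted-not-final : Disjoint (O (6 + k) ⊕ f (4 + k)) (singleton last-position)
    shifted-not-final p ((q , o , refl) , p≡last) = F-nonempty k (++-conicalˡ _ _ (++-conicalˡ _ _
      (last-position⇒after≡[] (occurrence-prefix {S = F (4 + k)} (F-shifted-occurrence k (occ (5 + k) o))) p≡last)))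

    shifted-bound : Occurrence (F (6 + k)) (F i) q → q + f (4 + k) ≤ f i ∸ f (5 + k) + 1
    shifted-bound {q} o =
      subst (λ l → q + f (4 + k) ≤ f i ∸ l + 1) length-shifted (occurrence-bound (F-shifted-occurrence k o))
      where
      length-shifted : length (F (4 + k) ++ F (1 + k) ++ F (2 + k)) ≡ f (5 + k)
      length-shifted = trans (length-++ (F (4 + k)))
        (trans (cong (f (4 + k) +_) (length-++-comm (F (1 + k)) (F (2 + k)))) (sym (length-++ (F (4 + k)))))

  even : j % 2 ≡ 0 → EvenCase i (4 + k) (5 + k) (6 + k)
  even j-even = decomposition , inside-shifted-disjoint , inside-not-final , shifted-not-final ,
                (final-occurrence j-even , λ _ o → occurrence-bound (occ (3 + k) o))
    where
    classify : Origin k (F (suc j)) (F i) p →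
               ((O (5 + k) ∪ (O (6 + k) ⊕ f (4 + k))) ∪ singleton last-position) p
    classify (inside o)       = inj₁ (inj₁ (occurrence⇒occursAt o))
    classify (shifted o p≡)   = inj₁ (inj₂ (_ , occurrence⇒occursAt o , p≡))
    classify (final p≡last _) = inj₂ p≡last
    decomposition : O (4 + k) ≐ ((O (5 + k) ∪ (O (6 + k) ⊕ f (4 + k))) ∪ singleton last-position)
    decomposition p = mk⇔ (λ o → classify (origin o)) λ
      { (inj₁ (inj₁ o))              → inside⊆ o
      ; (inj₁ (inj₂ (_ , o , refl))) → shifted⊆ o
      ; (inj₂ refl)                  → final-occurrence j-even }

  odd : j % 2 ≡ 1 → OddCase i (4 + k) (5 + k) (6 + k)
  odd j-odd = decomposition , inside-shifted-disjoint , (inside⊆ (final-occurrence j-odd) , maximal)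
    where
    classify : Origin k (F (suc j)) (F i) p → (O (5 + k) ∪ (O (6 + k) ⊕ f (4 + k))) p
    classify (inside o)      = inj₁ (occurrence⇒occursAt o)
    classify (shifted o p≡)  = inj₂ (_ , occurrence⇒occursAt o , p≡)
    classify (final _ φF≡)   = ⊥-elim (preimage-not-ending-in-a j-odd φF≡)
    decomposition : O (4 + k) ≐ (O (5 + k) ∪ (O (6 + k) ⊕ f (4 + k)))
    decomposition p = mk⇔ (λ o → classify (origin o)) λ
      { (inj₁ o)              → inside⊆ o
      ; (inj₂ (_ , o , refl)) → shifted⊆ o }
    maximal : ∀ p → O (4 + k) p → p ≤ f i ∸ f (5 + k) + 1
    maximal p o with origin o
    ... | inside o′       = occurrence-bound o′
    ... | shifted o′ refl = shifted-bound o′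
    ... | final _ φF≡     = ⊥-elim (preimage-not-ending-in-a j-odd φF≡)

RecurrenceAt : ℕ → ℕ → Set
RecurrenceAt i j = (j % 2 ≡ 0 → EvenCase i (i ∸ j) (i ∸ (j ∸ 1)) (i ∸ (j ∸ 2)))
                 × (j % 2 ≡ 1 → OddCase i (i ∸ j) (i ∸ (j ∸ 1)) (i ∸ (j ∸ 2)))

recurrence-at : ∀ j k → RecurrenceAt (2 + j + (4 + k)) (2 + j)
recurrence-at j k
  rewrite m+n∸m≡n j (4 + k)
        | trans (cong (_∸ j) (sym (+-suc j (4 + k)))) (m+n∸m≡n j (5 + k))
        | trans (cong (λ m → suc m ∸ j) (sym (+-suc j (4 + k))))
                (trans (cong (_∸ j) (sym (+-suc j (5 + k)))) (m+n∸m≡n j (6 + k)))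
  = Recurrence.even (2 + j) k , Recurrence.odd (2 + j) k

recurrence : ∀ i j → 2 ≤ j → j ≤ i ∸ 4 → RecurrenceAt i j
recurrence (suc (suc (suc (suc i)))) (suc (suc j)) (s≤s (s≤s z≤n)) j≤i =
  subst (λ i → RecurrenceAt i (2 + j)) (sym i≡) (recurrence-at j (i ∸ (2 + j)))
  where
  i≡ : 4 + i ≡ 2 + j + (4 + (i ∸ (2 + j)))
  i≡ = trans (cong (4 +_) (sym (m+[n∸m]≡n j≤i))) (x∙yz≈y∙xz 4 (2 + j) (i ∸ (2 + j)))
recurrence 0 (suc (suc j)) _ ()
recurrence 1 (suc (suc j)) _ ()
recurrence 2 (suc (suc j)) _ ()
recurrence 3 (suc (suc j)) _ ()

theorem16 : (i : ℕ) → 3 ≤ i →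
    (Θ i 0 ≐ singleton 1) × (Θ i 1 ≐ singleton 1) ×
    (∀ j → 2 ≤ j → j ≤ i ∸ 4 →
      (j % 2 ≡ 0 →
        (Θ i j ≐ ((Θ i (j ∸ 1) ∪ (Θ i (j ∸ 2) ⊕ f (i ∸ j))) ∪ singleton (f i ∸ f (i ∸ j) + 1)))
        × Disjoint (Θ i (j ∸ 1)) (Θ i (j ∸ 2) ⊕ f (i ∸ j))
        × Disjoint (Θ i (j ∸ 1)) (singleton (f i ∸ f (i ∸ j) + 1))
        × Disjoint (Θ i (j ∸ 2) ⊕ f (i ∸ j)) (singleton (f i ∸ f (i ∸ j) + 1))
        × IsMax (Θ i j) (f i ∸ f (i ∸ j) + 1))
      × (j % 2 ≡ 1 →
        (Θ i j ≐ (Θ i (j ∸ 1) ∪ (Θ i (j ∸ 2) ⊕ f (i ∸ j))))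
        × Disjoint (Θ i (j ∸ 1)) (Θ i (j ∸ 2) ⊕ f (i ∸ j))
        × IsMax (Θ i j) (f i ∸ f (i ∸ (j ∸ 1)) + 1)))
theorem16 (suc (suc (suc q))) (s≤s (s≤s (s≤s z≤n))) =
  self-occurrences (F-nonempty (2 + q)) , F-successor-occurrences q , recurrence (3 + q)
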